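{- Let $n\ge 1$ and let $\mathcal{M}_{2n}$ be the set of perfect matchings of $[2n]=\{1,\dots,2n\}$. For $\mathrm{M}\in\mathcal{M}_{2n}$ we have $\mathrm{so}(\mathrm{M})=\mathrm{oe}(\mathrm{M})+\mathrm{ee}(\mathrm{M})$. Moreover, letting $N(n,k)$ denote the number of $\mathrm{M}\in\mathcal{M}_{2n}$ with $\mathrm{so}(\mathrm{M})=k$, the numbers $N(n,k)$ satisfy the recurrence $$N(n+1,k)=2k\,N(n,k)+(2n-2k+3)\,N(n,k-1)$$ for $n,k\ge 1$, where $N(1,1)=1$ and $N(1,k)=0$ for $k\ge 2$ or $k\le 0$.
   Context: A perfect matching of $[2n]$ is a set partition of $[2n]$ into blocks of size exactly 2; each block is written $(a,b)$ with $a<b$ (so $a$ is its smaller entry). $\mathrm{so}(\mathrm{M})$ is the number of blocks of $\mathrm{M}$ whose smaller entry is odd. For a block $(a,b)$ with $a<b$: it is in $\mathrm{OO}(\mathrm{M})$ if $a,b$ are both odd, in $\mathrm{OE}(\mathrm{M})$ if $a$ is odd and $b$ even, in $\mathrm{EO}(\mathrm{M})$ if $a$ is even and $b$ odd, and in $\mathrm{EE}(\mathrm{M})$ if $a,b$ are both even. $\mathrm{oo}(\mathrm{M}),\mathrm{oe}(\mathrm{M}),\mathrm{eo}(\mathrm{M}),\mathrm{ee}(\mathrm{M})$ denote the cardinalities of these four sets. -}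

module Defs where

open import Data.Bool using (Bool; true; false; _∧_; not; T)
open import Data.Nat using (ℕ; zero; suc; _+_; _*_; _<ᵇ_; _≡ᵇ_)
open import Data.Fin using (Fin; toℕ; _≟_)
import Data.Vec
open Data.Vec using (Vec; lookup)
open import Data.List using (List; []; _∷_; [_]; map; concatMap; allFin; length; filterᵇ)
open import Data.Product using (Σ; _,_)
open import Relation.Nullary.Decidable using (isYes)

-- Encoding: the element  x ∈ [2n] = {1,…,2n}  is represented by  i : Fin (2 * n)
-- with  x = toℕ i + 1.  Hence x is odd  iff  toℕ i is even.
-- A perfect matching is encoded by its partner map  p : [2n] → [2n]
-- (stored as a vector), i.e. a fixed-point-free involution: the block
-- containing i is {i, p i}.

allᵇ : ∀ {A : Set} → (A → Bool) → List A → Bool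
allᵇ p [] = true
allᵇ p (x ∷ xs) = p x ∧ allᵇ p xs

evenᵇ : ℕ → Bool
evenᵇ zero = true
evenᵇ (suc m) = not (evenᵇ m)

_==ᶠ_ : ∀ {m} → Fin m → Fin m → Bool
i ==ᶠ j = isYes (i ≟ j)

isMatchingᵇ : ∀ {m} → Vec (Fin m) m → Bool
isMatchingᵇ {m} v =
  allᵇ (λ i → not (lookup v i ==ᶠ i) ∧ (lookup v (lookup v i) ==ᶠ i)) (allFin m)

Matching : ℕ → Set
Matching n = Σ (Vec (Fin (2 * n)) (2 * n)) (λ v → T (isMatchingᵇ v))

countᵇ : ∀ {m} → (Fin m → Bool) → ℕ
countᵇ {m} P = length (filterᵇ P (allFin m))

isOddElt : ∀ {m} → Fin m → Bool
isOddElt i = evenᵇ (toℕ i)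

isEvenElt : ∀ {m} → Fin m → Bool
isEvenElt i = not (evenᵇ (toℕ i))

isSmaller : ∀ {m} → Vec (Fin m) m → Fin m → Bool
isSmaller v i = toℕ i <ᵇ toℕ (lookup v i)

soVec : ∀ {m} → Vec (Fin m) m → ℕ
soVec v = countᵇ (λ i → isSmaller v i ∧ isOddElt i)

so : ∀ n → Matching n → ℕ
so n (v , _) = soVec v

oo oe eo ee : ∀ n → Matching n → ℕ
oo n (v , _) = countᵇ (λ i → isSmaller v i ∧ isOddElt i ∧ isOddElt (lookup v i))
oe n (v , _) = countᵇ (λ i → isSmaller v i ∧ isOddElt i ∧ isEvenElt (lookup v i))
eo n (v , _) = countᵇ (λ i → isSmaller v i ∧ isEvenElt i ∧ isOddElt (lookup v i))
ee n (v , _) = countᵇ (λ i → isSmaller v i ∧ isEvenElt i ∧ isEvenElt (lookup v i))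

vecs : ∀ {A : Set} → List A → (l : ℕ) → List (Vec A l)
vecs xs zero = [ Data.Vec.[] ]
vecs xs (suc l) = concatMap (λ x → map (x Data.Vec.∷_) (vecs xs l)) xs

matchingVecs : (n : ℕ) → List (Vec (Fin (2 * n)) (2 * n))
matchingVecs n = filterᵇ isMatchingᵇ (vecs (allFin (2 * n)) (2 * n))

N : ℕ → ℕ → ℕ
N n k = length (filterᵇ (λ v → soVec v ≡ᵇ k) (matchingVecs n))

-- First part: counting points according to the colour of their partner shows that for any
-- colouring with equally many points of each colour, there are as many blocks inside one colour
-- class as inside the other (balanced-blocks).  For the parity colouring this says oo = ee,
-- and so = oo + oe = ee + oe.
--
-- Second part: deleting the points 1, 2 of a matching of [m + 2] and joining their partners gives
-- its contraction, a matching of [m].  Conversely every matching p of [m] extends in m + 1 ways: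
-- add the block {1, 2} (joinNew) or split the block {a, p a} into {1, a + 2} and {2, p a + 2}
-- (splitBlock), and each matching of [m + 2] arises exactly once (sumBy-matchingList-2+).
-- As the shift by two preserves parity, every extension has so one larger than p, except that
-- splitting a block counted by so keeps it; this happens for exactly 2 so(p) values of a.
module Submission where

open import Defs
open import Data.Bool using (Bool; true; false; _∧_; _∨_; not)
import Data.Bool.Properties as BoolP
open import Data.Nat using (ℕ; zero; suc; _+_; _*_; _∸_; _≤_; s≤s; _<ᵇ_; _≡ᵇ_)
import Data.Nat.Properties as ℕP
open import Data.Nat.Tactic.RingSolver using (solve-∀)
open import Data.Fin using (Fin; toℕ; _≟_) renaming (zero to fz; suc to fs)
import Data.Fin.Properties as FinP
open import Data.List using (List; []; _∷_; _++_; map; tabulate; concat; concatMap; allFin; length; filterᵇ)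
import Data.List.Properties as ListP
open import Data.List.Relation.Unary.All using (All; []; _∷_)
import Data.List.Relation.Unary.All.Properties as AllP
open import Data.Vec using (Vec; lookup)
import Data.Vec as Vec
import Data.Vec.Properties as VecP
open import Data.Product using (Σ; _,_; proj₂; _×_)
open import Data.Empty using (⊥-elim)
open import Function.Bundles using (Equivalence)
open import Relation.Binary.Definitions using (DecidableEquality)
open import Relation.Binary.PropositionalEquality
  using (_≡_; _≢_; refl; sym; trans; cong; cong₂; subst; module ≡-Reasoning)
open import Relation.Nullary using (yes; no; ¬_)
open import Relation.Nullary.Decidable using (isYes)

⟦_⟧ : Bool → ℕ
⟦ true ⟧ = 1
⟦ false ⟧ = 0

sumBy : {A : Set} → (A → ℕ) → List A → ℕ
sumBy f [] = 0
sumBy f (x ∷ xs) = f x + sumBy f xs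

count-as-sum : {A : Set} (P : A → Bool) (xs : List A) →
               length (filterᵇ P xs) ≡ sumBy (λ x → ⟦ P x ⟧) xs
count-as-sum P [] = refl
count-as-sum P (x ∷ xs) with P x
... | true = cong suc (count-as-sum P xs)
... | false = count-as-sum P xs

sumBy-cong : {A : Set} {f g : A → ℕ} → (∀ x → f x ≡ g x) → ∀ xs → sumBy f xs ≡ sumBy g xs
sumBy-cong f≡g [] = refl
sumBy-cong f≡g (x ∷ xs) = cong₂ _+_ (f≡g x) (sumBy-cong f≡g xs)

sumBy-++ : {A : Set} (f : A → ℕ) (xs ys : List A) → sumBy f (xs ++ ys) ≡ sumBy f xs + sumBy f ys
sumBy-++ f [] ys = refl
sumBy-++ f (x ∷ xs) ys = trans (cong (λ t → f x + t) (sumBy-++ f xs ys)) (sym (ℕP.+-assoc (f x) _ _))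

sumBy-map : {A B : Set} (f : B → ℕ) (h : A → B) (xs : List A) → sumBy f (map h xs) ≡ sumBy (λ x → f (h x)) xs
sumBy-map f h [] = refl
sumBy-map f h (x ∷ xs) = cong (λ t → f (h x) + t) (sumBy-map f h xs)

sumBy-concatMap : {A B : Set} (f : B → ℕ) (h : A → List B) (xs : List A) →
                  sumBy f (concatMap h xs) ≡ sumBy (λ x → sumBy f (h x)) xs
sumBy-concatMap f h [] = refl
sumBy-concatMap f h (x ∷ xs) =
  trans (sumBy-++ f (h x) (concat (map h xs))) (cong (λ t → sumBy f (h x) + t) (sumBy-concatMap f h xs))

sumBy-0 : {A : Set} (xs : List A) → sumBy (λ _ → 0) xs ≡ 0
sumBy-0 [] = refl
sumBy-0 (_ ∷ xs) = sumBy-0 xs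

sumBy-+ : {A : Set} (f g : A → ℕ) (xs : List A) → sumBy (λ x → f x + g x) xs ≡ sumBy f xs + sumBy g xs
sumBy-+ f g [] = refl
sumBy-+ f g (x ∷ xs) = trans (cong (λ t → f x + g x + t) (sumBy-+ f g xs)) (interchange (f x) (g x) _ _)
  where
  interchange : ∀ a b c d → a + b + (c + d) ≡ a + c + (b + d)
  interchange = solve-∀

sumBy-* : {A : Set} (c : ℕ) (f : A → ℕ) (xs : List A) → sumBy (λ x → c * f x) xs ≡ c * sumBy f xs
sumBy-* c f [] = sym (ℕP.*-zeroʳ c)
sumBy-* c f (x ∷ xs) = trans (cong (λ t → c * f x + t) (sumBy-* c f xs)) (sym (ℕP.*-distribˡ-+ c (f x) _))

⟦∧⟧ : ∀ b c → ⟦ b ∧ c ⟧ ≡ ⟦ b ⟧ * ⟦ c ⟧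
⟦∧⟧ true c = sym (ℕP.+-identityʳ ⟦ c ⟧)
⟦∧⟧ false c = refl

sumBy-filter-cong : {A : Set} {f g : A → ℕ} (P : A → Bool) → (∀ x → P x ≡ true → f x ≡ g x) →
                    ∀ xs → sumBy f (filterᵇ P xs) ≡ sumBy g (filterᵇ P xs)
sumBy-filter-cong P f≡g [] = refl
sumBy-filter-cong P f≡g (x ∷ xs) with P x in px
... | true = cong₂ _+_ (f≡g x px) (sumBy-filter-cong P f≡g xs)
... | false = sumBy-filter-cong P f≡g xs

sumBy-filter : {A : Set} (f : A → ℕ) (P : A → Bool) (xs : List A) →
               sumBy f (filterᵇ P xs) ≡ sumBy (λ x → ⟦ P x ⟧ * f x) xs
sumBy-filter f P [] = refl
sumBy-filter f P (x ∷ xs) with P x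
... | true = cong₂ _+_ (sym (ℕP.+-identityʳ (f x))) (sumBy-filter f P xs)
... | false = sumBy-filter f P xs

sumBy-allFin-suc : ∀ n (f : Fin (suc n) → ℕ) →
                   sumBy f (allFin (suc n)) ≡ f fz + sumBy (λ i → f (fs i)) (allFin n)
sumBy-allFin-suc n f =
  cong (λ t → f fz + t) (trans (cong (sumBy f) (sym (ListP.map-tabulate (λ i → i) fs))) (sumBy-map f fs (allFin n)))

-- Two lists in which every
-- element has the same multiplicity are rearrangements of each other, so all
-- sums over them agree (sumBy-mult); this is how enumerations are reorganised.
module Multiplicity {A : Set} (_≟A_ : DecidableEquality A) where

  _==_ : A → A → Bool
  x == y = isYes (x ≟A y)

  ==-refl : ∀ x → (x == x) ≡ true
  ==-refl x with x ≟A x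
  ... | yes _ = refl
  ... | no x≢x = ⊥-elim (x≢x refl)

  ==-complete : ∀ {x y} → x ≡ y → (x == y) ≡ true
  ==-complete {x} refl = ==-refl x

  ==-sound : ∀ {x y} → (x == y) ≡ true → x ≡ y
  ==-sound {x} {y} eq with x ≟A y
  ... | yes x≡y = x≡y

  ==-≢ : ∀ {x y} → x ≢ y → (x == y) ≡ false
  ==-≢ {x} {y} x≢y with x ≟A y
  ... | yes x≡y = ⊥-elim (x≢y x≡y)
  ... | no _ = refl

  mult : A → List A → ℕ
  mult x = sumBy (λ y → ⟦ x == y ⟧)

  split : ∀ a ys → mult a ys ≢ 0 → Σ (List A) λ ys₁ → Σ (List A) λ ys₂ → ys ≡ ys₁ ++ a ∷ ys₂
  split a [] mult≢0 = ⊥-elim (mult≢0 refl)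
  split a (y ∷ ys) mult≢0 with a ≟A y
  ... | yes a≡y = [] , ys , cong (_∷ ys) (sym a≡y)
  ... | no _ with split a ys mult≢0
  ... | ys₁ , ys₂ , ys≡ = y ∷ ys₁ , ys₂ , cong (y ∷_) ys≡

  sumBy-mult : ∀ xs ys → (∀ x → mult x xs ≡ mult x ys) → ∀ (f : A → ℕ) → sumBy f xs ≡ sumBy f ys
  sumBy-mult [] [] same f = refl
  sumBy-mult [] (y ∷ ys) same f with same y
  ... | 0≡ rewrite ==-refl y = ⊥-elim (ℕP.0≢1+n 0≡)
  sumBy-mult (a ∷ xs) ys same f with split a ys a∈ys
    where
    a∈ys : mult a ys ≢ 0
    a∈ys ≡0 with trans (same a) ≡0
    ... | 1+≡0 rewrite ==-refl a = ℕP.1+n≢0 1+≡0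
  ... | ys₁ , ys₂ , refl = begin
      f a + sumBy f xs                ≡⟨ cong (λ t → f a + t) (sumBy-mult xs (ys₁ ++ ys₂) same′ f) ⟩
      f a + sumBy f (ys₁ ++ ys₂)      ≡⟨ move-a f ⟩
      sumBy f (ys₁ ++ a ∷ ys₂)        ∎
    where
    open ≡-Reasoning
    swap-front : ∀ p q r → p + (q + r) ≡ q + (p + r)
    swap-front = solve-∀
    move-a : ∀ (g : A → ℕ) → g a + sumBy g (ys₁ ++ ys₂) ≡ sumBy g (ys₁ ++ a ∷ ys₂)
    move-a g = begin
      g a + sumBy g (ys₁ ++ ys₂)         ≡⟨ cong (λ t → g a + t) (sumBy-++ g ys₁ ys₂) ⟩
      g a + (sumBy g ys₁ + sumBy g ys₂)  ≡⟨ swap-front (g a) (sumBy g ys₁) (sumBy g ys₂) ⟩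
      sumBy g ys₁ + (g a + sumBy g ys₂)  ≡⟨ sym (sumBy-++ g ys₁ (a ∷ ys₂)) ⟩
      sumBy g (ys₁ ++ a ∷ ys₂)           ∎
    same′ : ∀ x → mult x xs ≡ mult x (ys₁ ++ ys₂)
    same′ x = ℕP.+-cancelˡ-≡ ⟦ x == a ⟧ _ _ (trans (same x) (sym (move-a (λ y → ⟦ x == y ⟧))))

  sift : ∀ (P : A → Bool) x xs → sumBy (λ y → ⟦ (x == y) ∧ P y ⟧) xs ≡ ⟦ P x ⟧ * mult x xs
  sift P x [] = sym (ℕP.*-zeroʳ ⟦ P x ⟧)
  sift P x (y ∷ ys) with x ≟A y
  ... | yes refl = trans (cong (λ t → ⟦ P x ⟧ + t) (sift P x ys)) (sym (ℕP.*-suc ⟦ P x ⟧ _))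
  ... | no _ = sift P x ys

  guard-swap : ∀ (f : A → ℕ) x y → f y * ⟦ x == y ⟧ ≡ f x * ⟦ x == y ⟧
  guard-swap f x y with x ≟A y
  ... | yes refl = refl
  ... | no _ = trans (ℕP.*-zeroʳ (f y)) (sym (ℕP.*-zeroʳ (f x)))

  mult-filter : ∀ (P : A → Bool) x xs → mult x (filterᵇ P xs) ≡ ⟦ P x ⟧ * mult x xs
  mult-filter P x xs = begin
    mult x (filterᵇ P xs)                          ≡⟨ sumBy-filter _ P xs ⟩
    sumBy (λ y → ⟦ P y ⟧ * ⟦ x == y ⟧) xs          ≡⟨ sumBy-cong (guard-swap (λ y → ⟦ P y ⟧) x) xs ⟩
    sumBy (λ y → ⟦ P x ⟧ * ⟦ x == y ⟧) xs          ≡⟨ sumBy-* ⟦ P x ⟧ _ xs ⟩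
    ⟦ P x ⟧ * mult x xs                            ∎
    where open ≡-Reasoning

  mult-guard : ∀ (P : A → Bool) x {xs} → All (λ y → P y ≡ true) xs → mult x xs ≡ ⟦ P x ⟧ * mult x xs
  mult-guard P x [] = sym (ℕP.*-zeroʳ ⟦ P x ⟧)
  mult-guard P x {y ∷ ys} (Py ∷ Pys) with x ≟A y
  ... | yes refl rewrite Py = sym (ℕP.*-identityˡ _)
  ... | no _ = mult-guard P x Pys

module FinMult {m : ℕ} = Multiplicity (_≟_ {m})
module VecMult {m l : ℕ} = Multiplicity (VecP.≡-dec {n = l} (_≟_ {m}))
open VecMult using () renaming (_==_ to _==ᵛ_; mult to multᵛ)

mult-allFin : ∀ n (x : Fin n) → FinMult.mult x (allFin n) ≡ 1
mult-allFin (suc n) x = trans (sumBy-allFin-suc n (λ y → ⟦ x == y ⟧)) (at x)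
  where
  open FinMult
  ==-fs : ∀ (i j : Fin n) → (fs i == fs j) ≡ (i == j)
  ==-fs i j with i ≟ j
  ... | yes refl = refl
  ... | no _ = refl
  at : ∀ x → ⟦ x == fz ⟧ + sumBy (λ i → ⟦ x == fs i ⟧) (allFin n) ≡ 1
  at fz = cong suc (sumBy-0 (allFin n))
  at (fs y) = trans (sumBy-cong (λ i → cong ⟦_⟧ (==-fs y i)) (allFin n)) (mult-allFin n y)

mult-vecs : ∀ {m} (xs : List (Fin m)) → (∀ x → FinMult.mult x xs ≡ 1) →
            ∀ l (w : Vec (Fin m) l) → multᵛ w (vecs xs l) ≡ 1
mult-vecs xs once zero Vec.[] = refl
mult-vecs xs once (suc l) (y Vec.∷ w) = begin
    sumBy (λ u → ⟦ (y Vec.∷ w) ==ᵛ u ⟧) (concatMap (λ x → map (x Vec.∷_) (vecs xs l)) xs)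
      ≡⟨ sumBy-concatMap _ (λ x → map (x Vec.∷_) (vecs xs l)) xs ⟩
    sumBy (λ x → sumBy (λ u → ⟦ (y Vec.∷ w) ==ᵛ u ⟧) (map (x Vec.∷_) (vecs xs l))) xs
      ≡⟨ sumBy-cong row xs ⟩
    sumBy (λ x → ⟦ y ==ᶠ x ⟧ * 1) xs
      ≡⟨ sumBy-cong (λ x → ℕP.*-identityʳ ⟦ y ==ᶠ x ⟧) xs ⟩
    FinMult.mult y xs
      ≡⟨ once y ⟩
    1 ∎
  where
  open ≡-Reasoning
  ==-∷ : ∀ x u → ((y Vec.∷ w) ==ᵛ (x Vec.∷ u)) ≡ ((y ==ᶠ x) ∧ (w ==ᵛ u))
  ==-∷ x u with y ≟ x | VecP.≡-dec _≟_ w u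
  ... | yes _ | yes _ = refl
  ... | yes _ | no _ = refl
  ... | no _ | _ = refl
  row : ∀ x → sumBy (λ u → ⟦ (y Vec.∷ w) ==ᵛ u ⟧) (map (x Vec.∷_) (vecs xs l)) ≡ ⟦ y ==ᶠ x ⟧ * 1
  row x = begin
    sumBy (λ u → ⟦ (y Vec.∷ w) ==ᵛ u ⟧) (map (x Vec.∷_) (vecs xs l))
      ≡⟨ sumBy-map _ (x Vec.∷_) (vecs xs l) ⟩
    sumBy (λ u → ⟦ (y Vec.∷ w) ==ᵛ (x Vec.∷ u) ⟧) (vecs xs l)
      ≡⟨ sumBy-cong (λ u → trans (cong ⟦_⟧ (==-∷ x u)) (⟦∧⟧ (y ==ᶠ x) (w ==ᵛ u))) (vecs xs l) ⟩
    sumBy (λ u → ⟦ y ==ᶠ x ⟧ * ⟦ w ==ᵛ u ⟧) (vecs xs l)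
      ≡⟨ sumBy-* ⟦ y ==ᶠ x ⟧ _ (vecs xs l) ⟩
    ⟦ y ==ᶠ x ⟧ * multᵛ w (vecs xs l)
      ≡⟨ cong (⟦ y ==ᶠ x ⟧ *_) (mult-vecs xs once l w) ⟩
    ⟦ y ==ᶠ x ⟧ * 1 ∎

record PartnerMap {m : ℕ} (p : Fin m → Fin m) : Set where
  field
    no-fixpoint : ∀ i → p i ≢ i
    involutive  : ∀ i → p (p i) ≡ i
open PartnerMap

PartnerMap-cong : ∀ {m} {p q : Fin m → Fin m} → (∀ i → p i ≡ q i) → PartnerMap p → PartnerMap q
PartnerMap-cong {p = p} {q} p≗q pm = record
  { no-fixpoint = λ i qi≡i → no-fixpoint pm i (trans (p≗q i) qi≡i)
  ; involutive  = λ i → trans (sym (trans (cong p (p≗q i)) (p≗q (q i)))) (involutive pm i) }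

allᵇ-tabulate⁻ : ∀ {A : Set} n (g : Fin n → A) (f : A → Bool) → allᵇ f (tabulate g) ≡ true → ∀ i → f (g i) ≡ true
allᵇ-tabulate⁻ (suc n) g f all i with f (g fz) in head | i
... | true | fz = head
... | true | fs j = allᵇ-tabulate⁻ n (λ k → g (fs k)) f all j

allᵇ-tabulate⁺ : ∀ {A : Set} n (g : Fin n → A) (f : A → Bool) → (∀ i → f (g i) ≡ true) → allᵇ f (tabulate g) ≡ true
allᵇ-tabulate⁺ zero g f all = refl
allᵇ-tabulate⁺ (suc n) g f all rewrite all fz = allᵇ-tabulate⁺ n (λ k → g (fs k)) f (λ j → all (fs j))

partnerMap : ∀ {m} (v : Vec (Fin m) m) → isMatchingᵇ v ≡ true → PartnerMap (lookup v)
partnerMap {m} v matching = record { no-fixpoint = no-fixpoint′ ; involutive = involutive′ }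
  where
  open FinMult
  pointwise : ∀ i → (not (lookup v i ==ᶠ i) ∧ (lookup v (lookup v i) ==ᶠ i)) ≡ true
  pointwise = allᵇ-tabulate⁻ m (λ i → i) _ matching
  no-fixpoint′ : ∀ i → lookup v i ≢ i
  no-fixpoint′ i vi≡i with pointwise i
  ... | ok rewrite vi≡i | ==-refl i with ok
  ... | ()
  involutive′ : ∀ i → lookup v (lookup v i) ≡ i
  involutive′ i with lookup v i ==ᶠ i | pointwise i
  ... | false | ok = ==-sound ok

isMatching : ∀ {m} (v : Vec (Fin m) m) → PartnerMap (lookup v) → isMatchingᵇ v ≡ true
isMatching {m} v pm = allᵇ-tabulate⁺ m (λ i → i) _ pointwise
  where
  open FinMult
  pointwise : ∀ i → (not (lookup v i ==ᶠ i) ∧ (lookup v (lookup v i) ==ᶠ i)) ≡ true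
  pointwise i rewrite ==-≢ (no-fixpoint pm i) | involutive pm i = ==-refl i

#[_] : ∀ {m} → (Fin m → Bool) → ℕ
#[_] {m} P = sumBy (λ i → ⟦ P i ⟧) (allFin m)

#-cong : ∀ {m} {P Q : Fin m → Bool} → (∀ i → P i ≡ Q i) → #[ P ] ≡ #[ Q ]
#-cong {m} P≗Q = sumBy-cong (λ i → cong ⟦_⟧ (P≗Q i)) (allFin m)

#-split : ∀ {m} (Q P : Fin m → Bool) → #[ P ] ≡ #[ (λ i → Q i ∧ P i) ] + #[ (λ i → not (Q i) ∧ P i) ]
#-split {m} Q P = trans (sumBy-cong (λ i → by-cases (Q i) (P i)) (allFin m)) (sumBy-+ _ _ (allFin m))
  where
  by-cases : ∀ q b → ⟦ b ⟧ ≡ ⟦ q ∧ b ⟧ + ⟦ not q ∧ b ⟧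
  by-cases true b = sym (ℕP.+-identityʳ ⟦ b ⟧)
  by-cases false b = refl

#-complement : ∀ {m} (P : Fin m → Bool) → #[ P ] + #[ (λ i → not (P i)) ] ≡ m
#-complement {m} P = trans (sym (sumBy-+ _ _ (allFin m))) (trans (sumBy-cong (λ i → one (P i)) (allFin m)) (count-all m))
  where
  one : ∀ b → ⟦ b ⟧ + ⟦ not b ⟧ ≡ 1
  one true = refl
  one false = refl
  count-all : ∀ n → sumBy (λ (_ : Fin n) → 1) (allFin n) ≡ n
  count-all zero = refl
  count-all (suc n) = trans (sumBy-allFin-suc n (λ _ → 1)) (cong suc (count-all n))

sumBy-involution : ∀ {m} (p : Fin m → Fin m) → (∀ i → p (p i) ≡ i) →
                   ∀ (f : Fin m → ℕ) → sumBy (λ i → f (p i)) (allFin m) ≡ sumBy f (allFin m)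
sumBy-involution {m} p inv f =
  trans (sym (sumBy-map f p (allFin m))) (sumBy-mult (map p (allFin m)) (allFin m) once-each f)
  where
  open FinMult
  transpose : ∀ x y → (x == p y) ≡ (p x == y)
  transpose x y with x ≟ p y
  ... | yes refl = sym (==-complete (inv y))
  ... | no x≢py = sym (==-≢ (λ px≡y → x≢py (trans (sym (inv x)) (cong p px≡y))))
  once-each : ∀ x → mult x (map p (allFin m)) ≡ mult x (allFin m)
  once-each x = begin
    mult x (map p (allFin m))                  ≡⟨ sumBy-map _ p (allFin m) ⟩
    sumBy (λ y → ⟦ x == p y ⟧) (allFin m)     ≡⟨ sumBy-cong (λ y → cong ⟦_⟧ (transpose x y)) (allFin m) ⟩
    mult (p x) (allFin m)                      ≡⟨ mult-allFin m (p x) ⟩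
    1                                          ≡⟨ sym (mult-allFin m x) ⟩
    mult x (allFin m)                          ∎
    where open ≡-Reasoning

_≺_ : ∀ {m} → Fin m → Fin m → Bool
i ≺ j = toℕ i <ᵇ toℕ j

≺-flip : ∀ {m} (i j : Fin m) → i ≢ j → (i ≺ j) ≡ not (j ≺ i)
≺-flip i j i≢j = flip (toℕ i) (toℕ j) (λ eq → i≢j (FinP.toℕ-injective eq))
  where
  flip : ∀ x y → x ≢ y → (x <ᵇ y) ≡ not (y <ᵇ x)
  flip zero zero x≢y = ⊥-elim (x≢y refl)
  flip zero (suc y) _ = refl
  flip (suc x) zero _ = refl
  flip (suc x) (suc y) x≢y = flip x y (λ eq → x≢y (cong suc eq))

-- Counting the points i with c (i, p i) block by block: each block {a < b}
-- contributes c (a, b) from a and c (b, a) from b.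
#-by-blocks : ∀ {m} (p : Fin m → Fin m) → PartnerMap p → (c : Fin m → Fin m → Bool) →
              #[ (λ i → c i (p i)) ] ≡ #[ (λ i → (i ≺ p i) ∧ c i (p i)) ] + #[ (λ i → (i ≺ p i) ∧ c (p i) i) ]
#-by-blocks p pm c =
  trans (#-split (λ i → i ≺ p i) (λ i → c i (p i)))
        (cong (λ t → #[ (λ i → (i ≺ p i) ∧ c i (p i)) ] + t)
              (trans (#-cong larger-entry) (sumBy-involution p (involutive pm) (λ j → ⟦ (j ≺ p j) ∧ c (p j) j ⟧))))
  where
  larger-entry : ∀ i → (not (i ≺ p i) ∧ c i (p i)) ≡ ((p i ≺ p (p i)) ∧ c (p (p i)) (p i))
  larger-entry i rewrite involutive pm i =
    cong (_∧ c i (p i)) (sym (≺-flip (p i) i (no-fixpoint pm i)))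

balanced-blocks : ∀ {m} (p : Fin m → Fin m) → PartnerMap p → (C : Fin m → Bool) →
                  #[ C ] ≡ #[ (λ i → not (C i)) ] →
                  #[ (λ i → (i ≺ p i) ∧ C i ∧ C (p i)) ] ≡ #[ (λ i → (i ≺ p i) ∧ not (C i) ∧ not (C (p i))) ]
balanced-blocks {m} p pm C balanced = ℕP.*-cancelˡ-≡ (blocksIn C) (blocksIn C̄) 2 (begin
    2 * blocksIn C                 ≡⟨ sym (inside C) ⟩
    #[ (λ i → C (p i) ∧ C i) ]     ≡⟨ ℕP.+-cancelʳ-≡ #[ crossing C ] _ _ points ⟩
    #[ (λ i → C̄ (p i) ∧ C̄ i) ]     ≡⟨ inside C̄ ⟩
    2 * blocksIn C̄                 ∎)
  where
  open ≡-Reasoning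
  C̄ : Fin m → Bool
  C̄ i = not (C i)
  blocksIn : (Fin m → Bool) → ℕ
  blocksIn X = #[ (λ i → (i ≺ p i) ∧ X i ∧ X (p i)) ]
  -- the points of a block inside X are counted by both of its entries
  inside : ∀ X → #[ (λ i → X (p i) ∧ X i) ] ≡ 2 * blocksIn X
  inside X = begin
    #[ (λ i → X (p i) ∧ X i) ]
      ≡⟨ #-by-blocks p pm (λ i j → X j ∧ X i) ⟩
    #[ (λ i → (i ≺ p i) ∧ X (p i) ∧ X i) ] + blocksIn X
      ≡⟨ cong (_+ blocksIn X) (#-cong (λ i → cong ((i ≺ p i) ∧_) (BoolP.∧-comm (X (p i)) (X i)))) ⟩
    blocksIn X + blocksIn X
      ≡⟨ cong (blocksIn X +_) (sym (ℕP.+-identityʳ (blocksIn X))) ⟩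
    2 * blocksIn X ∎
  crossing : (Fin m → Bool) → Fin m → Bool
  crossing X i = not (X (p i)) ∧ X i
  -- the blocks meeting both C and C̄ are seen once from each side
  crossing-swap : #[ crossing C̄ ] ≡ #[ crossing C ]
  crossing-swap = trans (sym (sumBy-involution p (involutive pm) (λ j → ⟦ crossing C̄ j ⟧))) (#-cong other-end)
    where
    other-end : ∀ i → crossing C̄ (p i) ≡ crossing C i
    other-end i rewrite involutive pm i | BoolP.not-involutive (C i) = BoolP.∧-comm (C i) (not (C (p i)))
  points : #[ (λ i → C (p i) ∧ C i) ] + #[ crossing C ] ≡ #[ (λ i → C̄ (p i) ∧ C̄ i) ] + #[ crossing C ]
  points = begin
    #[ (λ i → C (p i) ∧ C i) ] + #[ crossing C ]    ≡⟨ sym (#-split (λ i → C (p i)) C) ⟩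
    #[ C ]                                          ≡⟨ balanced ⟩
    #[ C̄ ]                                          ≡⟨ #-split (λ i → C̄ (p i)) C̄ ⟩
    #[ (λ i → C̄ (p i) ∧ C̄ i) ] + #[ crossing C̄ ]  ≡⟨ cong (#[ (λ i → C̄ (p i) ∧ C̄ i) ] +_) crossing-swap ⟩
    #[ (λ i → C̄ (p i) ∧ C̄ i) ] + #[ crossing C ]   ∎

-- Shifting by one exchanges odd and even positions.
#odd-suc : ∀ m → #[ isOddElt {suc m} ] ≡ suc #[ isEvenElt {m} ]
#odd-suc m = sumBy-allFin-suc m (λ i → ⟦ isOddElt i ⟧)

#even-suc : ∀ m → #[ isEvenElt {suc m} ] ≡ #[ isOddElt {m} ]
#even-suc m = trans (sumBy-allFin-suc m (λ i → ⟦ isEvenElt i ⟧))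
                    (#-cong {m} (λ i → BoolP.not-involutive (isOddElt i)))

balance-step : ∀ m → #[ isOddElt {m} ] ≡ #[ isEvenElt {m} ] → #[ isOddElt {2 + m} ] ≡ #[ isEvenElt {2 + m} ]
balance-step m balanced = begin
  #[ isOddElt {2 + m} ]         ≡⟨ #odd-suc (suc m) ⟩
  suc #[ isEvenElt {1 + m} ]    ≡⟨ cong suc (#even-suc m) ⟩
  suc #[ isOddElt {m} ]         ≡⟨ cong suc balanced ⟩
  suc #[ isEvenElt {m} ]        ≡⟨ sym (#odd-suc m) ⟩
  #[ isOddElt {1 + m} ]         ≡⟨ sym (#even-suc (suc m)) ⟩
  #[ isEvenElt {2 + m} ]        ∎
  where open ≡-Reasoning

odd-even-balanced : ∀ n → #[ isOddElt {2 * n} ] ≡ #[ isEvenElt {2 * n} ]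
odd-even-balanced zero = refl
odd-even-balanced (suc n) = subst (λ m → #[ isOddElt {m} ] ≡ #[ isEvenElt {m} ]) (sym (ℕP.*-suc 2 n))
                                  (balance-step (2 * n) (odd-even-balanced n))

-- First part of the theorem: the blocks with odd smaller entry are the OO- and
-- OE-blocks, and by balanced-blocks there are as many OO-blocks as EE-blocks.
so≡oe+ee : ∀ n (M : Matching n) → so n M ≡ oe n M + ee n M
so≡oe+ee n (v , matching) = begin
    so n (v , matching)
      ≡⟨ count-as-sum _ (allFin (2 * n)) ⟩
    #[ (λ i → (i ≺ p i) ∧ O i) ]
      ≡⟨ trans (sumBy-cong (λ i → by-partner (i ≺ p i) (O i) (O (p i))) (allFin (2 * n))) (sumBy-+ _ _ (allFin (2 * n))) ⟩
    #[ (λ i → (i ≺ p i) ∧ O i ∧ O (p i)) ] + #[ (λ i → (i ≺ p i) ∧ O i ∧ E (p i)) ]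
      ≡⟨ cong (_+ #[ (λ i → (i ≺ p i) ∧ O i ∧ E (p i)) ])
              (balanced-blocks p (partnerMap v (Equivalence.to BoolP.T-≡ matching)) O (odd-even-balanced n)) ⟩
    #[ (λ i → (i ≺ p i) ∧ E i ∧ E (p i)) ] + #[ (λ i → (i ≺ p i) ∧ O i ∧ E (p i)) ]
      ≡⟨ ℕP.+-comm #[ (λ i → (i ≺ p i) ∧ E i ∧ E (p i)) ] _ ⟩
    #[ (λ i → (i ≺ p i) ∧ O i ∧ E (p i)) ] + #[ (λ i → (i ≺ p i) ∧ E i ∧ E (p i)) ]
      ≡⟨ sym (cong₂ _+_ (count-as-sum _ (allFin (2 * n))) (count-as-sum _ (allFin (2 * n)))) ⟩
    oe n (v , matching) + ee n (v , matching) ∎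
  where
  open ≡-Reasoning
  p = lookup v
  O E : Fin (2 * n) → Bool
  O = isOddElt
  E = isEvenElt
  by-partner : ∀ a b c → ⟦ a ∧ b ⟧ ≡ ⟦ a ∧ b ∧ c ⟧ + ⟦ a ∧ b ∧ not c ⟧
  by-partner true true true = refl
  by-partner true true false = refl
  by-partner true false c = refl
  by-partner false b c = refl

-- Fin (2 + m) consists of two new points new₀, new₁ followed by a shifted copy of Fin m.
-- Shifting by two preserves parity, so these are the points 1, 2 of [2 + m] and the old points.
pattern new₀ = fz
pattern new₁ = fs fz
pattern shift j = fs (fs j)

shift-injective : ∀ {m} {i j : Fin m} → shift i ≡ shift j → i ≡ j
shift-injective refl = refl

shift≢new₀ : ∀ {m} {j : Fin m} → _≢_ {A = Fin (2 + m)} (shift j) new₀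
shift≢new₀ ()

shift≢new₁ : ∀ {m} {j : Fin m} → _≢_ {A = Fin (2 + m)} (shift j) new₁
shift≢new₁ ()

new₀≢new₁ : ∀ {m} → _≢_ {A = Fin (2 + m)} new₀ new₁
new₀≢new₁ ()

joinNew : ∀ {m} → (Fin m → Fin m) → Fin (2 + m) → Fin (2 + m)
joinNew p new₀ = new₁
joinNew p new₁ = new₀
joinNew p (shift j) = shift (p j)

splitBlock : ∀ {m} → (Fin m → Fin m) → Fin m → Fin (2 + m) → Fin (2 + m)
splitBlock p a new₀ = shift a
splitBlock p a new₁ = shift (p a)
splitBlock p a (shift j) with j ≟ a
... | yes _ = new₀
... | no _ with j ≟ p a
...   | yes _ = new₁
...   | no _ = shift (p j)

splitBlock-at-a : ∀ {m} (p : Fin m → Fin m) a → splitBlock p a (shift a) ≡ new₀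
splitBlock-at-a p a with a ≟ a
... | yes _ = refl
... | no a≢a = ⊥-elim (a≢a refl)

splitBlock-at-pa : ∀ {m} (p : Fin m → Fin m) a → p a ≢ a → splitBlock p a (shift (p a)) ≡ new₁
splitBlock-at-pa p a pa≢a with p a ≟ a
... | yes pa≡a = ⊥-elim (pa≢a pa≡a)
... | no _ with p a ≟ p a
...   | yes _ = refl
...   | no pa≢pa = ⊥-elim (pa≢pa refl)

splitBlock-elsewhere : ∀ {m} (p : Fin m → Fin m) a j → j ≢ a → j ≢ p a → splitBlock p a (shift j) ≡ shift (p j)
splitBlock-elsewhere p a j j≢a j≢pa with j ≟ a
... | yes j≡a = ⊥-elim (j≢a j≡a)
... | no _ with j ≟ p a
...   | yes j≡pa = ⊥-elim (j≢pa j≡pa)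
...   | no _ = refl

partner-injective : ∀ {m} {w : Fin m → Fin m} → PartnerMap w → ∀ {x y} → w x ≡ w y → x ≡ y
partner-injective {w = w} pm {x} {y} wx≡wy = trans (sym (involutive pm x)) (trans (cong w wx≡wy) (involutive pm y))

partner-swap : ∀ {m} {w : Fin m → Fin m} → PartnerMap w → ∀ {x y} → w x ≡ y → w y ≡ x
partner-swap {w = w} pm {x} wx≡y = trans (cong w (sym wx≡y)) (involutive pm x)

joinNew-partner : ∀ {m} (p : Fin m → Fin m) → PartnerMap p → PartnerMap (joinNew p)
joinNew-partner p pm = record { no-fixpoint = no-fixpoint′ ; involutive = involutive′ }
  where
  no-fixpoint′ : ∀ i → joinNew p i ≢ i
  no-fixpoint′ new₀ ()
  no-fixpoint′ new₁ ()
  no-fixpoint′ (shift j) eq = no-fixpoint pm j (shift-injective eq)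
  involutive′ : ∀ i → joinNew p (joinNew p i) ≡ i
  involutive′ new₀ = refl
  involutive′ new₁ = refl
  involutive′ (shift j) = cong shift (involutive pm j)

splitBlock-partner : ∀ {m} (p : Fin m → Fin m) a → PartnerMap p → PartnerMap (splitBlock p a)
splitBlock-partner p a pm = record { no-fixpoint = no-fixpoint′ ; involutive = involutive′ }
  where
  no-fixpoint′ : ∀ i → splitBlock p a i ≢ i
  no-fixpoint′ new₀ ()
  no-fixpoint′ new₁ ()
  no-fixpoint′ (shift j) with j ≟ a
  ... | yes _ = λ ()
  ... | no _ with j ≟ p a
  ...   | yes _ = λ ()
  ...   | no _ = λ eq → no-fixpoint pm j (shift-injective eq)
  involutive′ : ∀ i → splitBlock p a (splitBlock p a i) ≡ i
  involutive′ new₀ = splitBlock-at-a p a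
  involutive′ new₁ = splitBlock-at-pa p a (no-fixpoint pm a)
  involutive′ (shift j) with j ≟ a
  ... | yes j≡a = cong shift (sym j≡a)
  ... | no j≢a with j ≟ p a
  ...   | yes j≡pa = cong shift (sym j≡pa)
  ...   | no j≢pa = trans (splitBlock-elsewhere p a (p j) pj≢a pj≢pa) (cong shift (involutive pm j))
    where
    pj≢a : p j ≢ a
    pj≢a pj≡a = j≢pa (trans (sym (involutive pm j)) (cong p pj≡a))
    pj≢pa : p j ≢ p a
    pj≢pa pj≡pa = j≢a (partner-injective pm pj≡pa)

-- Contracting a matching w of Fin (2 + m): delete new₀ and new₁ and join their partners.
-- unshift's second argument is a default that is never used when w is a partner map.
unshift : ∀ {m} → Fin (2 + m) → Fin m → Fin m
unshift (shift y) _ = y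
unshift new₀ default = default
unshift new₁ default = default

reconnect : ∀ {m} → Fin (2 + m) → Fin (2 + m) → Fin (2 + m) → Fin m → Fin m
reconnect (shift y) partner₀ partner₁ j = y
reconnect new₀ partner₀ partner₁ j = unshift partner₁ j
reconnect new₁ partner₀ partner₁ j = unshift partner₀ j

contract : ∀ {m} → (Fin (2 + m) → Fin (2 + m)) → Fin m → Fin m
contract w j = reconnect (w (shift j)) (w new₀) (w new₁) j

-- Linked w j k: j and k become partners when w is contracted, either directly or
-- because j and k were paired with the two new points.
data Linked {m} (w : Fin (2 + m) → Fin (2 + m)) (j k : Fin m) : Set where
  direct : w (shift j) ≡ shift k → Linked w j k
  via₀   : w (shift j) ≡ new₀ → w new₁ ≡ shift k → Linked w j k
  via₁   : w (shift j) ≡ new₁ → w new₀ ≡ shift k → Linked w j k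

contract-linked : ∀ {m} {w : Fin (2 + m) → Fin (2 + m)} {j k} → Linked w j k → contract w j ≡ k
contract-linked (direct e) rewrite e = refl
contract-linked (via₀ e e₁) rewrite e | e₁ = refl
contract-linked (via₁ e e₀) rewrite e | e₀ = refl

linked-contract : ∀ {m} {w : Fin (2 + m) → Fin (2 + m)} → PartnerMap w → ∀ j → Linked w j (contract w j)
linked-contract {w = w} pm j = to-contract (proj₂ (some-link (w (shift j)) refl))
  where
  to-contract : ∀ {k} → Linked w j k → Linked w j (contract w j)
  to-contract link = subst (Linked w j) (sym (contract-linked link)) link
  some-link : ∀ u → w (shift j) ≡ u → Σ (Fin _) (Linked w j)
  some-link (shift k) e = k , direct e
  some-link new₀ e with w new₁ in e₁
  ... | shift k = k , via₀ e e₁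
  ... | new₀ = ⊥-elim (shift≢new₁ (partner-injective pm (trans e (sym e₁))))
  ... | new₁ = ⊥-elim (no-fixpoint pm new₁ e₁)
  some-link new₁ e with w new₀ in e₀
  ... | shift k = k , via₁ e e₀
  ... | new₀ = ⊥-elim (no-fixpoint pm new₀ e₀)
  ... | new₁ = ⊥-elim (shift≢new₀ (partner-injective pm (trans e (sym e₀))))

linked-sym : ∀ {m} {w : Fin (2 + m) → Fin (2 + m)} → PartnerMap w → ∀ {j k} → Linked w j k → Linked w k j
linked-sym pm (direct e) = direct (partner-swap pm e)
linked-sym pm (via₀ e e₁) = via₁ (partner-swap pm e₁) (partner-swap pm e)
linked-sym pm (via₁ e e₀) = via₀ (partner-swap pm e₀) (partner-swap pm e)

linked-irrefl : ∀ {m} {w : Fin (2 + m) → Fin (2 + m)} → PartnerMap w → ∀ {j} → ¬ Linked w j j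
linked-irrefl pm (direct e) = no-fixpoint pm _ e
linked-irrefl pm (via₀ e e₁) = new₀≢new₁ (partner-injective pm (trans (partner-swap pm e) (sym e₁)))
linked-irrefl pm (via₁ e e₀) = new₀≢new₁ (partner-injective pm (trans e₀ (sym (partner-swap pm e))))

contract-partner : ∀ {m} (w : Fin (2 + m) → Fin (2 + m)) → PartnerMap w → PartnerMap (contract w)
contract-partner w pm = record
  { no-fixpoint = λ j eq → linked-irrefl pm (subst (Linked w j) eq (linked-contract pm j))
  ; involutive  = λ j → contract-linked (linked-sym pm (linked-contract pm j)) }

-- Contraction undoes both kinds of extension.  The statements allow any w that agrees
-- pointwise with the extension (as lookup ∘ tabulate does).
contract-joinNew : ∀ {m} {w : Fin (2 + m) → Fin (2 + m)} (p : Fin m → Fin m) →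
                   (∀ i → w i ≡ joinNew p i) → ∀ j → contract w j ≡ p j
contract-joinNew {w = w} p w≗ j = contract-linked {w = w} (direct (w≗ (shift j)))

contract-splitBlock : ∀ {m} {w : Fin (2 + m) → Fin (2 + m)} (p : Fin m → Fin m) a → PartnerMap p →
                      (∀ i → w i ≡ splitBlock p a i) → ∀ j → contract w j ≡ p j
contract-splitBlock {w = w} p a pm w≗ j with j ≟ a
... | yes refl = contract-linked {w = w} (via₀ (trans (w≗ (shift j)) (splitBlock-at-a p j)) (w≗ new₁))
... | no j≢a with j ≟ p a
...   | yes refl = contract-linked {w = w} (via₁ (trans (w≗ (shift (p a))) (splitBlock-at-pa p a j≢a))
                                          (trans (w≗ new₀) (cong shift (sym (involutive pm a)))))
...   | no j≢pa = contract-linked {w = w} (direct (trans (w≗ (shift j)) (splitBlock-elsewhere p a j j≢a j≢pa)))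

-- Conversely a perfect matching w of Fin (2 + m) is recovered from its contraction q
-- and the partner of new₀: if new₀ is paired with new₁, w = joinNew q ...
joinNew-contract : ∀ {m} (w : Fin (2 + m) → Fin (2 + m)) (q : Fin m → Fin m) → PartnerMap w →
                   w new₀ ≡ new₁ → (∀ j → contract w j ≡ q j) → ∀ i → w i ≡ joinNew q i
joinNew-contract w q pm w₀ contract≗ new₀ = w₀
joinNew-contract w q pm w₀ contract≗ new₁ = partner-swap pm w₀
joinNew-contract w q pm w₀ contract≗ (shift j) with linked-contract pm j
... | direct e = trans e (cong shift (contract≗ j))
... | via₀ e _ = ⊥-elim (shift≢new₁ (partner-injective pm (trans e (sym (partner-swap pm w₀)))))
... | via₁ e _ = ⊥-elim (shift≢new₀ (partner-injective pm (trans e (sym w₀))))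

-- ... and if new₀ is paired with shift a, then w = splitBlock q a.
splitBlock-contract : ∀ {m} (w : Fin (2 + m) → Fin (2 + m)) (q : Fin m → Fin m) a → PartnerMap w →
                      w new₀ ≡ shift a → (∀ j → contract w j ≡ q j) → ∀ i → w i ≡ splitBlock q a i
splitBlock-contract w q a pm w₀ contract≗ = at
  where
  wa : w (shift a) ≡ new₀
  wa = partner-swap pm w₀
  w₁ : w new₁ ≡ shift (q a)
  w₁ with linked-contract pm a
  ... | direct e = ⊥-elim (shift≢new₀ (trans (sym e) wa))
  ... | via₀ _ e₁ = trans e₁ (cong shift (contract≗ a))
  ... | via₁ e _ = ⊥-elim (new₀≢new₁ (trans (sym wa) e))
  at : ∀ i → w i ≡ splitBlock q a i
  at new₀ = w₀
  at new₁ = w₁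
  at (shift j) with j ≟ a
  ... | yes refl = wa
  ... | no j≢a with j ≟ q a
  ...   | yes refl = partner-swap pm w₁
  ...   | no j≢qa with linked-contract pm j
  ...     | direct e = trans e (cong shift (contract≗ j))
  ...     | via₀ e _ = ⊥-elim (j≢a (shift-injective (trans (sym (partner-swap pm e)) w₀)))
  ...     | via₁ e _ = ⊥-elim (j≢qa (shift-injective (trans (sym (partner-swap pm e)) w₁)))

-- The perfect matchings of Fin m as partner vectors; Defs' matchingVecs n is matchingList (2 * n).
matchingList : ∀ m → List (Vec (Fin m) m)
matchingList m = filterᵇ isMatchingᵇ (vecs (allFin m) m)

extensions : ∀ {m} → Vec (Fin m) m → List (Vec (Fin (2 + m)) (2 + m))
extensions {m} v = Vec.tabulate (joinNew (lookup v)) ∷ map (λ a → Vec.tabulate (splitBlock (lookup v) a)) (allFin m)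

contraction : ∀ {m} → Vec (Fin (2 + m)) (2 + m) → Vec (Fin m) m
contraction w = Vec.tabulate (contract (lookup w))

mult-matchingList : ∀ m (w : Vec (Fin m) m) → multᵛ w (matchingList m) ≡ ⟦ isMatchingᵇ w ⟧
mult-matchingList m w =
  trans (VecMult.mult-filter isMatchingᵇ w (vecs (allFin m) m))
        (trans (cong (⟦ isMatchingᵇ w ⟧ *_) (mult-vecs (allFin m) (mult-allFin m) m w)) (ℕP.*-identityʳ _))

==ᵛ-tabulate : ∀ {m l} (w : Vec (Fin m) l) (f : Fin l → Fin m) → (∀ i → lookup w i ≡ f i) → (w ==ᵛ Vec.tabulate f) ≡ true
==ᵛ-tabulate w f w≗f =
  subst (λ u → (w ==ᵛ u) ≡ true) (trans (sym (VecP.tabulate∘lookup w)) (VecP.tabulate-cong w≗f)) (VecMult.==-refl w)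

==ᵛ-at : ∀ {m l} (w x : Vec (Fin m) l) i → lookup w i ≢ lookup x i → (w ==ᵛ x) ≡ false
==ᵛ-at w x i differ = VecMult.==-≢ (λ w≡x → differ (cong (λ u → lookup u i) w≡x))

extension-valid : ∀ {m} (v : Vec (Fin m) m) → isMatchingᵇ v ≡ true →
                  All (λ x → (isMatchingᵇ x ∧ (contraction x ==ᵛ v)) ≡ true) (extensions v)
extension-valid {m} v matching =
  valid (joinNew p) (joinNew-partner p pm) (contract-joinNew p)
  ∷ AllP.map⁺ (AllP.tabulate⁺ (λ a → valid (splitBlock p a) (splitBlock-partner p a pm) (contract-splitBlock p a pm)))
  where
  p = lookup v
  pm = partnerMap v matching
  valid : (f : Fin (2 + m) → Fin (2 + m)) → PartnerMap f →
          (∀ {w} → (∀ i → w i ≡ f i) → ∀ j → contract w j ≡ p j) →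
          (isMatchingᵇ (Vec.tabulate f) ∧ (contraction (Vec.tabulate f) ==ᵛ v)) ≡ true
  valid f fm contracts rewrite isMatching (Vec.tabulate f) (PartnerMap-cong (λ i → sym (VecP.lookup∘tabulate f i)) fm) =
    trans (cong (_==ᵛ v) (VecP.tabulate-cong (contracts (VecP.lookup∘tabulate f))))
          (trans (cong (_==ᵛ v) (VecP.tabulate∘lookup v)) (VecMult.==-refl v))

-- A matching w contracting to v occurs exactly once among the extensions of v:
-- the partner of new₀ tells which one it is.
extension-unique : ∀ {m} (v : Vec (Fin m) m) (w : Vec (Fin (2 + m)) (2 + m)) →
                   isMatchingᵇ w ≡ true → contraction w ≡ v → multᵛ w (extensions v) ≡ 1
extension-unique {m} v w matching refl = by-partner-of-new₀ (lookup w new₀) refl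
  where
  open ≡-Reasoning
  pm = partnerMap w matching
  q = lookup (contraction w)
  split = λ a → Vec.tabulate (splitBlock q a)
  contract≗ : ∀ j → contract (lookup w) j ≡ q j
  contract≗ j = sym (VecP.lookup∘tabulate (contract (lookup w)) j)
  by-partner-of-new₀ : ∀ x → lookup w new₀ ≡ x → multᵛ w (extensions (contraction w)) ≡ 1
  by-partner-of-new₀ new₀ w₀ = ⊥-elim (no-fixpoint pm new₀ w₀)
  by-partner-of-new₀ new₁ w₀ = begin
    ⟦ w ==ᵛ Vec.tabulate (joinNew q) ⟧ + sumBy (λ x → ⟦ w ==ᵛ x ⟧) (map split (allFin m))
      ≡⟨ cong₂ _+_ (cong ⟦_⟧ (==ᵛ-tabulate w _ (joinNew-contract (lookup w) q pm w₀ contract≗)))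
                    (sumBy-map _ split (allFin m)) ⟩
    1 + sumBy (λ a → ⟦ w ==ᵛ split a ⟧) (allFin m)
      ≡⟨ cong suc (sumBy-cong (λ a → cong ⟦_⟧ (not-split a)) (allFin m)) ⟩
    1 + sumBy (λ _ → 0) (allFin m)
      ≡⟨ cong suc (sumBy-0 (allFin m)) ⟩
    1 ∎
    where
    not-split : ∀ a → (w ==ᵛ split a) ≡ false
    not-split a = ==ᵛ-at w (split a) new₀ (λ eq → shift≢new₁ (trans (sym eq) w₀))
  by-partner-of-new₀ (shift a₀) w₀ = begin
    ⟦ w ==ᵛ Vec.tabulate (joinNew q) ⟧ + sumBy (λ x → ⟦ w ==ᵛ x ⟧) (map split (allFin m))
      ≡⟨ cong₂ _+_ (cong ⟦_⟧ (==ᵛ-at w _ new₀ (λ eq → shift≢new₁ (trans (sym w₀) eq))))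
                    (sumBy-map _ split (allFin m)) ⟩
    sumBy (λ a → ⟦ w ==ᵛ split a ⟧) (allFin m)
      ≡⟨ sumBy-cong (λ a → cong ⟦_⟧ (which a)) (allFin m) ⟩
    FinMult.mult a₀ (allFin m)
      ≡⟨ mult-allFin m a₀ ⟩
    1 ∎
    where
    which : ∀ a → (w ==ᵛ split a) ≡ (a₀ ==ᶠ a)
    which a with a₀ ≟ a
    ... | yes refl = ==ᵛ-tabulate w _ (splitBlock-contract (lookup w) q a pm w₀ contract≗)
    ... | no a₀≢a = ==ᵛ-at w (split a) new₀ (λ eq → a₀≢a (shift-injective (trans (sym w₀) eq)))

mult-extensions : ∀ {m} (v : Vec (Fin m) m) → isMatchingᵇ v ≡ true → ∀ w →
                  multᵛ w (extensions v) ≡ ⟦ isMatchingᵇ w ∧ (contraction w ==ᵛ v) ⟧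
mult-extensions v matching w
  with VecMult.mult-guard (λ x → isMatchingᵇ x ∧ (contraction x ==ᵛ v)) w (extension-valid v matching)
... | guarded with isMatchingᵇ w in w-matching | contraction w ==ᵛ v in contracts
...   | false | _ = guarded
...   | true | false = guarded
...   | true | true = extension-unique v w w-matching (VecMult.==-sound contracts)

mult-all-extensions : ∀ m (w : Vec (Fin (2 + m)) (2 + m)) →
                      multᵛ w (concatMap extensions (matchingList m)) ≡ ⟦ isMatchingᵇ w ⟧
mult-all-extensions m w = begin
    multᵛ w (concatMap extensions (matchingList m))
      ≡⟨ sumBy-concatMap _ extensions (matchingList m) ⟩
    sumBy (λ v → multᵛ w (extensions v)) (matchingList m)
      ≡⟨ sumBy-filter-cong isMatchingᵇ (λ v matching → mult-extensions v matching w) (vecs (allFin m) m) ⟩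
    sumBy (λ v → ⟦ isMatchingᵇ w ∧ (contraction w ==ᵛ v) ⟧) (matchingList m)
      ≡⟨ sumBy-cong (λ v → ⟦∧⟧ (isMatchingᵇ w) (contraction w ==ᵛ v)) (matchingList m) ⟩
    sumBy (λ v → ⟦ isMatchingᵇ w ⟧ * ⟦ contraction w ==ᵛ v ⟧) (matchingList m)
      ≡⟨ sumBy-* ⟦ isMatchingᵇ w ⟧ _ (matchingList m) ⟩
    ⟦ isMatchingᵇ w ⟧ * multᵛ (contraction w) (matchingList m)
      ≡⟨ cong (⟦ isMatchingᵇ w ⟧ *_) (mult-matchingList m (contraction w)) ⟩
    ⟦ isMatchingᵇ w ⟧ * ⟦ isMatchingᵇ (contraction w) ⟧
      ≡⟨ contraction-matching (isMatchingᵇ w) refl ⟩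
    ⟦ isMatchingᵇ w ⟧ ∎
  where
  open ≡-Reasoning
  contraction-matching : ∀ b → isMatchingᵇ w ≡ b → ⟦ b ⟧ * ⟦ isMatchingᵇ (contraction w) ⟧ ≡ ⟦ b ⟧
  contraction-matching false _ = refl
  contraction-matching true matching
    rewrite isMatching (contraction w) (PartnerMap-cong (λ j → sym (VecP.lookup∘tabulate _ j))
                                         (contract-partner (lookup w) (partnerMap w matching))) = refl

sumBy-matchingList-2+ : ∀ m (f : Vec (Fin (2 + m)) (2 + m) → ℕ) →
                        sumBy f (matchingList (2 + m)) ≡ sumBy (λ v → sumBy f (extensions v)) (matchingList m)
sumBy-matchingList-2+ m f =
  trans (VecMult.sumBy-mult (matchingList (2 + m)) (concatMap extensions (matchingList m))
          (λ w → trans (mult-matchingList (2 + m) w) (sym (mult-all-extensions m w))) f)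
        (sumBy-concatMap f extensions (matchingList m))

oddOpener : ∀ {m} → (Fin m → Fin m) → Fin m → Bool
oddOpener p j = (j ≺ p j) ∧ isOddElt j

soOf : ∀ {m} → (Fin m → Fin m) → ℕ
soOf p = #[ oddOpener p ]

soVec-tabulate : ∀ {m} (f : Fin m → Fin m) → soVec (Vec.tabulate f) ≡ soOf f
soVec-tabulate {m} f = trans (count-as-sum _ (allFin m))
  (#-cong (λ i → cong (λ j → (i ≺ j) ∧ isOddElt i) (VecP.lookup∘tabulate f i)))

-- On Fin (2 + m): new₀ is odd, new₁ is even, and shifting preserves parity.
soOf-peel : ∀ {m} (f : Fin (2 + m) → Fin (2 + m)) →
            soOf f ≡ ⟦ new₀ ≺ f new₀ ⟧ + #[ (λ j → (shift j ≺ f (shift j)) ∧ isOddElt j) ]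
soOf-peel {m} f = begin
    soOf f
      ≡⟨ sumBy-allFin-suc (suc m) (λ i → ⟦ oddOpener f i ⟧) ⟩
    ⟦ (new₀ ≺ f new₀) ∧ true ⟧ + sumBy (λ i → ⟦ oddOpener f (fs i) ⟧) (allFin (suc m))
      ≡⟨ cong₂ _+_ (cong ⟦_⟧ (BoolP.∧-identityʳ (new₀ ≺ f new₀)))
                   (sumBy-allFin-suc m (λ i → ⟦ oddOpener f (fs i) ⟧)) ⟩
    ⟦ new₀ ≺ f new₀ ⟧ + (⟦ (new₁ ≺ f new₁) ∧ false ⟧
                        + #[ (λ j → (shift j ≺ f (shift j)) ∧ not (not (isOddElt j))) ])
      ≡⟨ cong (λ t → ⟦ new₀ ≺ f new₀ ⟧ + t)
              (cong₂ _+_ (cong ⟦_⟧ (BoolP.∧-zeroʳ (new₁ ≺ f new₁)))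
                         (#-cong (λ j → cong ((shift j ≺ f (shift j)) ∧_) (BoolP.not-involutive (isOddElt j))))) ⟩
    ⟦ new₀ ≺ f new₀ ⟧ + #[ (λ j → (shift j ≺ f (shift j)) ∧ isOddElt j) ] ∎
  where open ≡-Reasoning

-- The new block {new₀, new₁} has the odd smaller entry new₀.
so-joinNew : ∀ {m} (p : Fin m → Fin m) → soOf (joinNew p) ≡ suc (soOf p)
so-joinNew p = soOf-peel (joinNew p)

counted : ∀ {m} → (Fin m → Fin m) → Fin m → Bool
counted p a = oddOpener p a ∨ oddOpener p (p a)

module _ {m} {p : Fin m → Fin m} (pm : PartnerMap p) where

  -- only one entry of a block is its smaller entry
  not-both-openers : ∀ a → (oddOpener p a ∧ oddOpener p (p a)) ≡ false
  not-both-openers a rewrite involutive pm a | ≺-flip a (p a) (λ a≡pa → no-fixpoint pm a (sym a≡pa)) =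
    exclusive (p a ≺ a) (isOddElt a) (isOddElt (p a))
    where
    exclusive : ∀ y c d → ((not y ∧ c) ∧ (y ∧ d)) ≡ false
    exclusive true c d = refl
    exclusive false false d = refl
    exclusive false true d = refl

  ⟦counted⟧ : ∀ a → ⟦ counted p a ⟧ ≡ ⟦ oddOpener p a ⟧ + ⟦ oddOpener p (p a) ⟧
  ⟦counted⟧ a = disjoint (oddOpener p a) (oddOpener p (p a)) (not-both-openers a)
    where
    disjoint : ∀ x y → (x ∧ y) ≡ false → ⟦ x ∨ y ⟧ ≡ ⟦ x ⟧ + ⟦ y ⟧
    disjoint true true ()
    disjoint true false _ = refl
    disjoint false y _ = refl

  -- each counted block is counted from both of its entries
  #counted : #[ counted p ] ≡ 2 * soOf p
  #counted = begin
    #[ counted p ]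
      ≡⟨ trans (sumBy-cong ⟦counted⟧ (allFin m)) (sumBy-+ _ _ (allFin m)) ⟩
    soOf p + sumBy (λ a → ⟦ oddOpener p (p a) ⟧) (allFin m)
      ≡⟨ cong (soOf p +_) (sumBy-involution p (involutive pm) (λ j → ⟦ oddOpener p j ⟧)) ⟩
    soOf p + soOf p
      ≡⟨ cong (soOf p +_) (sym (ℕP.+-identityʳ (soOf p))) ⟩
    2 * soOf p ∎
    where open ≡-Reasoning

  -- Splitting the block {a, p a} replaces it by {new₀, a} (counted) and {new₁, p a}
  -- (not counted) and leaves all other blocks alone.
  so-splitBlock : ∀ a → soOf (splitBlock p a) + ⟦ counted p a ⟧ ≡ suc (soOf p)
  so-splitBlock a = begin
      soOf (splitBlock p a) + ⟦ counted p a ⟧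
        ≡⟨ cong₂ _+_ (trans (soOf-peel (splitBlock p a)) (cong suc (#-cong untouched))) (⟦counted⟧ a) ⟩
      suc (#[ elsewhere ] + (⟦ oddOpener p a ⟧ + ⟦ oddOpener p (p a) ⟧))
        ≡⟨ cong suc (sym so-by-block) ⟩
      suc (soOf p) ∎
    where
    open ≡-Reasoning
    open FinMult using (==-refl; ==-≢; sift)
    elsewhere : Fin m → Bool
    elsewhere j = (not (a ==ᶠ j) ∧ not (p a ==ᶠ j)) ∧ oddOpener p j
    untouched : ∀ j → ((shift j ≺ splitBlock p a (shift j)) ∧ isOddElt j) ≡ elsewhere j
    untouched j with j ≟ a
    ... | yes refl rewrite ==-refl j = refl
    ... | no j≢a with j ≟ p a
    ...   | yes refl rewrite ==-refl (p a) | BoolP.∧-zeroʳ (not (a ==ᶠ p a)) = refl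
    ...   | no j≢pa rewrite ==-≢ (λ a≡j → j≢a (sym a≡j)) | ==-≢ (λ pa≡j → j≢pa (sym pa≡j)) = refl
    by-membership : ∀ x y b → (x ∧ y) ≡ false → ⟦ b ⟧ ≡ ⟦ (not x ∧ not y) ∧ b ⟧ + (⟦ x ∧ b ⟧ + ⟦ y ∧ b ⟧)
    by-membership true true b ()
    by-membership true false b _ = sym (ℕP.+-identityʳ ⟦ b ⟧)
    by-membership false true b _ = refl
    by-membership false false b _ = sym (ℕP.+-identityʳ ⟦ b ⟧)
    a-or-pa : ∀ j → ((a ==ᶠ j) ∧ (p a ==ᶠ j)) ≡ false
    a-or-pa j with a ≟ j
    ... | no _ = refl
    ... | yes refl = ==-≢ (no-fixpoint pm j)
    pick : ∀ c → #[ (λ j → (c ==ᶠ j) ∧ oddOpener p j) ] ≡ ⟦ oddOpener p c ⟧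
    pick c = trans (sift (oddOpener p) c (allFin m))
                   (trans (cong (⟦ oddOpener p c ⟧ *_) (mult-allFin m c)) (ℕP.*-identityʳ _))
    so-by-block : soOf p ≡ #[ elsewhere ] + (⟦ oddOpener p a ⟧ + ⟦ oddOpener p (p a) ⟧)
    so-by-block = begin
      soOf p
        ≡⟨ sumBy-cong (λ j → by-membership (a ==ᶠ j) (p a ==ᶠ j) (oddOpener p j) (a-or-pa j)) (allFin m) ⟩
      sumBy (λ j → ⟦ elsewhere j ⟧ + (⟦ (a ==ᶠ j) ∧ oddOpener p j ⟧ + ⟦ (p a ==ᶠ j) ∧ oddOpener p j ⟧)) (allFin m)
        ≡⟨ trans (sumBy-+ _ _ (allFin m)) (cong (#[ elsewhere ] +_) (sumBy-+ _ _ (allFin m))) ⟩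
      #[ elsewhere ] + (#[ (λ j → (a ==ᶠ j) ∧ oddOpener p j) ] + #[ (λ j → (p a ==ᶠ j) ∧ oddOpener p j) ])
        ≡⟨ cong (#[ elsewhere ] +_) (cong₂ _+_ (pick a) (pick (p a))) ⟩
      #[ elsewhere ] + (⟦ oddOpener p a ⟧ + ⟦ oddOpener p (p a) ⟧) ∎

-- How the extensions of a matching v distribute over the values of so: joinNew and
-- splitting an uncounted block raise so by one, splitting a counted block keeps it.
so-extensions : ∀ {m} (v : Vec (Fin m) m) → isMatchingᵇ v ≡ true → ∀ k →
                let p = lookup v; s = soOf p in
                sumBy (λ w → ⟦ soVec w ≡ᵇ k ⟧) (extensions v)
                  ≡ ⟦ suc s ≡ᵇ k ⟧ + (⟦ s ≡ᵇ k ⟧ * #[ counted p ]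
                                      + ⟦ suc s ≡ᵇ k ⟧ * #[ (λ a → not (counted p a)) ])
so-extensions {m} v matching k = cong₂ _+_
    (cong (λ t → ⟦ t ≡ᵇ k ⟧) (trans (soVec-tabulate (joinNew p)) (so-joinNew p)))
    (begin
      sumBy (λ w → ⟦ soVec w ≡ᵇ k ⟧) (map split (allFin m))
        ≡⟨ sumBy-map _ split (allFin m) ⟩
      sumBy (λ a → ⟦ soVec (split a) ≡ᵇ k ⟧) (allFin m)
        ≡⟨ sumBy-cong (λ a → by-counted (soVec (split a)) (counted p a)
                               (trans (cong (_+ ⟦ counted p a ⟧) (soVec-tabulate (splitBlock p a))) (so-splitBlock pm a)))
                      (allFin m) ⟩
      sumBy (λ a → ⟦ s ≡ᵇ k ⟧ * ⟦ counted p a ⟧ + ⟦ suc s ≡ᵇ k ⟧ * ⟦ not (counted p a) ⟧) (allFin m)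
        ≡⟨ sumBy-+ _ _ (allFin m) ⟩
      sumBy (λ a → ⟦ s ≡ᵇ k ⟧ * ⟦ counted p a ⟧) (allFin m)
        + sumBy (λ a → ⟦ suc s ≡ᵇ k ⟧ * ⟦ not (counted p a) ⟧) (allFin m)
        ≡⟨ cong₂ _+_ (sumBy-* ⟦ s ≡ᵇ k ⟧ _ (allFin m)) (sumBy-* ⟦ suc s ≡ᵇ k ⟧ _ (allFin m)) ⟩
      ⟦ s ≡ᵇ k ⟧ * #[ counted p ] + ⟦ suc s ≡ᵇ k ⟧ * #[ (λ a → not (counted p a)) ] ∎)
  where
  open ≡-Reasoning
  p = lookup v
  pm = partnerMap v matching
  s = soOf p
  split = λ a → Vec.tabulate (splitBlock p a)
  by-counted : ∀ q b → q + ⟦ b ⟧ ≡ suc s → ⟦ q ≡ᵇ k ⟧ ≡ ⟦ s ≡ᵇ k ⟧ * ⟦ b ⟧ + ⟦ suc s ≡ᵇ k ⟧ * ⟦ not b ⟧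
  by-counted q true eq rewrite ℕP.suc-injective (trans (ℕP.+-comm 1 q) eq) =
    sym (trans (cong₂ _+_ (ℕP.*-identityʳ ⟦ s ≡ᵇ k ⟧) (ℕP.*-zeroʳ ⟦ suc s ≡ᵇ k ⟧)) (ℕP.+-identityʳ _))
  by-counted q false eq rewrite trans (sym (ℕP.+-identityʳ q)) eq =
    sym (cong₂ _+_ (ℕP.*-zeroʳ ⟦ s ≡ᵇ k ⟧) (ℕP.*-identityʳ ⟦ suc s ≡ᵇ k ⟧))

≡ᵇ-suc : ∀ k → (k ≡ᵇ suc k) ≡ false
≡ᵇ-suc zero = refl
≡ᵇ-suc (suc k) = ≡ᵇ-suc k

recurrence-arith : ∀ s k C U m → C ≡ 2 * s → C + U ≡ m →
                   ⟦ suc s ≡ᵇ suc k ⟧ + (⟦ s ≡ᵇ suc k ⟧ * C + ⟦ suc s ≡ᵇ suc k ⟧ * U) + 2 * k * ⟦ s ≡ᵇ k ⟧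
                     ≡ 2 * suc k * ⟦ s ≡ᵇ suc k ⟧ + (1 + m) * ⟦ s ≡ᵇ k ⟧
recurrence-arith s k C U m refl refl with s ≡ᵇ k in s≡k
... | true rewrite ℕP.≡ᵇ⇒≡ s k (Equivalence.from BoolP.T-≡ s≡k) | ≡ᵇ-suc k = so-equals-k k U
  where
  so-equals-k : ∀ k U → 1 + (0 * (2 * k) + 1 * U) + 2 * k * 1 ≡ 2 * suc k * 0 + (1 + (2 * k + U)) * 1
  so-equals-k = solve-∀
... | false with s ≡ᵇ suc k in s≡1+k
...   | true rewrite ℕP.≡ᵇ⇒≡ s (suc k) (Equivalence.from BoolP.T-≡ s≡1+k) = so-equals-1+k k U
  where
  so-equals-1+k : ∀ k U → 0 + (1 * (2 * suc k) + 0 * U) + 2 * k * 0 ≡ 2 * suc k * 1 + (1 + (2 * suc k + U)) * 0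
  so-equals-1+k = solve-∀
...   | false = so-elsewhere k s U
  where
  so-elsewhere : ∀ k s U → 0 + (0 * (2 * s) + 0 * U) + 2 * k * 0 ≡ 2 * suc k * 0 + (1 + (2 * s + U)) * 0
  so-elsewhere = solve-∀

-- Nso m k: the number of perfect matchings of Fin m with so = k; the paper's N(n, k) is Nso (2 * n) k.
Nso : ℕ → ℕ → ℕ
Nso m k = length (filterᵇ (λ v → soVec v ≡ᵇ k) (matchingList m))

-- The recurrence over ℕ, with the negative term moved to the left.
Nso-recurrence : ∀ m k → Nso (2 + m) (suc k) + 2 * k * Nso m k ≡ 2 * suc k * Nso m (suc k) + (1 + m) * Nso m k
Nso-recurrence m k = begin
    Nso (2 + m) (suc k) + 2 * k * Nso m k
      ≡⟨ cong₂ _+_ (trans (count-as-sum _ (matchingList (2 + m))) (sumBy-matchingList-2+ m (λ w → ⟦ soVec w ≡ᵇ suc k ⟧)))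
                   (trans (cong (2 * k *_) (count-as-sum _ L)) (sym (sumBy-* (2 * k) _ L))) ⟩
    sumBy (λ v → sumBy (λ w → ⟦ soVec w ≡ᵇ suc k ⟧) (extensions v)) L + sumBy (λ v → 2 * k * ⟦ soVec v ≡ᵇ k ⟧) L
      ≡⟨ sym (sumBy-+ _ _ L) ⟩
    sumBy (λ v → sumBy (λ w → ⟦ soVec w ≡ᵇ suc k ⟧) (extensions v) + 2 * k * ⟦ soVec v ≡ᵇ k ⟧) L
      ≡⟨ sumBy-filter-cong isMatchingᵇ one-matching (vecs (allFin m) m) ⟩
    sumBy (λ v → 2 * suc k * ⟦ soVec v ≡ᵇ suc k ⟧ + (1 + m) * ⟦ soVec v ≡ᵇ k ⟧) L
      ≡⟨ sumBy-+ _ _ L ⟩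
    sumBy (λ v → 2 * suc k * ⟦ soVec v ≡ᵇ suc k ⟧) L + sumBy (λ v → (1 + m) * ⟦ soVec v ≡ᵇ k ⟧) L
      ≡⟨ cong₂ _+_ (trans (sumBy-* (2 * suc k) _ L) (cong (2 * suc k *_) (sym (count-as-sum _ L))))
                   (trans (sumBy-* (1 + m) _ L) (cong ((1 + m) *_) (sym (count-as-sum _ L)))) ⟩
    2 * suc k * Nso m (suc k) + (1 + m) * Nso m k ∎
  where
  open ≡-Reasoning
  L = matchingList m
  one-matching : ∀ v → isMatchingᵇ v ≡ true →
                 sumBy (λ w → ⟦ soVec w ≡ᵇ suc k ⟧) (extensions v) + 2 * k * ⟦ soVec v ≡ᵇ k ⟧
                   ≡ 2 * suc k * ⟦ soVec v ≡ᵇ suc k ⟧ + (1 + m) * ⟦ soVec v ≡ᵇ k ⟧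
  one-matching v matching rewrite count-as-sum (λ i → isSmaller v i ∧ isOddElt i) (allFin m) =
    trans (cong (_+ 2 * k * ⟦ soOf p ≡ᵇ k ⟧) (so-extensions v matching (suc k)))
          (recurrence-arith (soOf p) k #[ counted p ] #[ (λ a → not (counted p a)) ] m
                            (#counted (partnerMap v matching)) (#-complement (counted p)))
    where p = lookup v

open import Data.Integer using (ℤ; +_; -_) renaming (_+_ to _+ℤ_; _*_ to _*ℤ_)
import Data.Integer.Properties as ℤP
import Data.Integer.Tactic.RingSolver as ℤSolver

ℕ-equation→ℤ : ∀ X u a b B → X + b * B ≡ u + a * B → + X ≡ + u +ℤ ((+ a +ℤ - + b) *ℤ + B)
ℕ-equation→ℤ X u a b B eq = begin
    + X                                      ≡⟨ add-sub (+ X) (+ (b * B)) ⟩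
    (+ X +ℤ + (b * B)) +ℤ - + (b * B)        ≡⟨ cong (_+ℤ - + (b * B)) (sym (ℤP.pos-+ X (b * B))) ⟩
    + (X + b * B) +ℤ - + (b * B)             ≡⟨ cong (λ t → + t +ℤ - + (b * B)) eq ⟩
    + (u + a * B) +ℤ - + (b * B)             ≡⟨ cong (_+ℤ - + (b * B)) (ℤP.pos-+ u (a * B)) ⟩
    (+ u +ℤ + (a * B)) +ℤ - + (b * B)        ≡⟨ cong₂ (λ y z → (+ u +ℤ y) +ℤ - z) (ℤP.pos-* a B) (ℤP.pos-* b B) ⟩
    (+ u +ℤ + a *ℤ + B) +ℤ - (+ b *ℤ + B)   ≡⟨ collect (+ u) (+ a) (+ b) (+ B) ⟩
    + u +ℤ ((+ a +ℤ - + b) *ℤ + B)          ∎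
  where
  open ≡-Reasoning
  add-sub : ∀ (x y : ℤ) → x ≡ (x +ℤ y) +ℤ - y
  add-sub = ℤSolver.solve-∀
  collect : ∀ (u a b B : ℤ) → (u +ℤ a *ℤ B) +ℤ - (b *ℤ B) ≡ u +ℤ ((a +ℤ - b) *ℤ B)
  collect = ℤSolver.solve-∀

N-recurrence : ∀ n k → 1 ≤ k → + N (suc n) k ≡ + (2 * k * N n k) +ℤ ((+ (2 * n + 3) +ℤ - + (2 * k)) *ℤ + N n (k ∸ 1))
N-recurrence n (suc k) _ = ℕ-equation→ℤ X (2 * suc k * A) (2 * n + 3) (2 * suc k) B (begin
    X + 2 * suc k * B                        ≡⟨ regroup X k B ⟩
    (X + 2 * k * B) + 2 * B                  ≡⟨ cong (_+ 2 * B) recurrence ⟩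
    2 * suc k * A + (1 + 2 * n) * B + 2 * B  ≡⟨ regroup′ k A B n ⟩
    2 * suc k * A + (2 * n + 3) * B          ∎)
  where
  open ≡-Reasoning
  X = N (suc n) (suc k)
  A = N n (suc k)
  B = N n k
  recurrence : X + 2 * k * B ≡ 2 * suc k * A + (1 + 2 * n) * B
  recurrence = subst (λ m → Nso m (suc k) + 2 * k * B ≡ 2 * suc k * A + (1 + 2 * n) * B)
                     (sym (ℕP.*-suc 2 n)) (Nso-recurrence (2 * n) k)
  regroup : ∀ X k B → X + 2 * suc k * B ≡ (X + 2 * k * B) + 2 * B
  regroup = solve-∀
  regroup′ : ∀ k A B n → 2 * suc k * A + (1 + 2 * n) * B + 2 * B ≡ 2 * suc k * A + (2 * n + 3) * B
  regroup′ = solve-∀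

-- The initial values are computed directly: 𝓜₂ consists of the single matching {1, 2}.
N₁-large : (k : ℕ) → 2 ≤ k → N 1 k ≡ 0
N₁-large (suc zero) (s≤s ())
N₁-large (suc (suc k)) _ = refl

proposition1 :
    ((n : ℕ) → 1 ≤ n → (M : Matching n) → so n M ≡ oe n M + ee n M)
    × ((n k : ℕ) → 1 ≤ n → 1 ≤ k →
        + N (suc n) k ≡ + (2 * k * N n k) +ℤ ((+ (2 * n + 3) +ℤ - + (2 * k)) *ℤ + N n (k ∸ 1)))
    × (N 1 1 ≡ 1)
    × ((k : ℕ) → 2 ≤ k → N 1 k ≡ 0)
    × (N 1 0 ≡ 0)
proposition1 = (λ n _ → so≡oe+ee n) , (λ n k _ → N-recurrence n k) , refl , N₁-large , refl
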